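{- Let $F$ be rule $12$ on the triangular grid, let $c$ be a configuration and $u$ a cell, and suppose the distance $d$ from $u$ to the nearest cell that is active in $c$ satisfies $d\ge 2$. Then the distance from $u$ to the nearest cell that is active in $F(c)$ is $d-1$.
   Context: Triangular grid: the plane tessellated by equilateral triangles; each triangle (cell) has three neighbors, the triangles sharing an edge with it; $N(u)$ is the set of neighbors of $u$. The distance between two cells is the length of a shortest path between them in the graph whose vertices are the cells and whose edges join neighboring cells. A configuration assigns each cell a state in $\{0,1\}$ (1 = active, 0 = inactive). Rule $12$ is the synchronous map $F(c)_u=1$ if $c_u=1$ or $\sum_{v\in N(u)}c_v\in\{1,2\}$, and $F(c)_u=0$ otherwise. -}

module Defs where

open import Data.Bool using (Bool; true; false; _∨_)
open import Data.Nat using (ℕ; zero; suc; _+_; _≤_)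
open import Data.Integer using (ℤ; +_) renaming (_+_ to _+ℤ_; _-_ to _-ℤ_)
open import Data.Product using (_×_; _,_; Σ; ∃-syntax)
open import Data.List using (List; _∷_; []; map)
open import Data.Nat.ListAction using (sum)
open import Data.List.Membership.Propositional using (_∈_)
open import Relation.Binary.PropositionalEquality using (_≡_)

data Orient : Set where
  up down : Orient

-- A cell: the triangles are indexed by a lattice point (x , y) of the
-- underlying rhombic (parallelogram) lattice and an orientation; each
-- rhombus is split into one up-triangle and one down-triangle.
Cell : Set
Cell = ℤ × ℤ × Orient

N : Cell → List Cell
N (x , y , up)   = (x , y , down) ∷ (x -ℤ + 1 , y , down) ∷ (x , y -ℤ + 1 , down) ∷ []
N (x , y , down) = (x , y , up)   ∷ (x +ℤ + 1 , y , up)   ∷ (x , y +ℤ + 1 , up)   ∷ []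

-- Configurations: true = active (1), false = inactive (0).
Config : Set
Config = Cell → Bool

toℕ : Bool → ℕ
toℕ true  = 1
toℕ false = 0

activeNbrs : Config → Cell → ℕ
activeNbrs c u = sum (map (λ v → toℕ (c v)) (N u))

inOneTwo : ℕ → Bool
inOneTwo 1 = true
inOneTwo 2 = true
inOneTwo _ = false

F : Config → Config
F c u = c u ∨ inOneTwo (activeNbrs c u)

data Walk : Cell → Cell → ℕ → Set where
  here : ∀ {u} → Walk u u 0
  step : ∀ {u v w n} → v ∈ N u → Walk v w n → Walk u w (suc n)

Dist : Cell → Cell → ℕ → Set
Dist u v d = Walk u v d × (∀ m → Walk u v m → d ≤ m)

NearestActiveDist : Config → Cell → ℕ → Set
NearestActiveDist c u d =
  (∃[ v ] (c v ≡ true × Dist u v d))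
  × (∀ v e → c v ≡ true → Dist u v e → d ≤ e)

module Submission where

-- Upper bound.  Take a shortest walk u ⋯ w₂ – w₁ – v to an active cell v.
-- The cell w₂ lies at distance d - 2 < d from u, so it is inactive; hence
-- w₁ has an active neighbour (v) and an inactive one (w₂).  A cell has
-- exactly three neighbours, so w₁ sees 1 or 2 active neighbours and is
-- active in F(c).  The prefix u ⋯ w₁ of a shortest walk is shortest, so
-- w₁ lies at distance d - 1.
--
-- Lower bound.  A cell active in F(c) is active in c or has an active
-- neighbour in c; either way it is at distance ≥ d - 1 from u.

open import Defs
open import Data.Bool using (Bool; true; false; _∨_)
open import Data.Bool.Properties using (∨-zeroʳ)
open import Data.Nat using (ℕ; zero; suc; _≤_; _<_; _∸_; z≤n; s≤s)
open import Data.Nat.Properties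
  using (≤-refl; ≤-trans; ≤-pred; <⇒≤; ≮⇒≥; m≤n⇒m≤1+n; m≤n+m; +-mono-≤; +-mono-≤-<; <-irrefl; anyUpTo?)
open import Data.Nat.Induction using (<-rec)
open import Data.Integer using (ℤ; +_; -_) renaming (_+_ to _+ℤ_; _-_ to _-ℤ_)
import Data.Integer as ℤ
import Data.Integer.Properties as ℤₚ
open import Data.Product using (_×_; _,_; proj₁; ∃-syntax)
open import Data.Product.Properties using (≡-dec)
open import Data.Sum using (_⊎_; inj₁; inj₂)
open import Data.List using (List; _∷_; []; map; length)
open import Data.Nat.ListAction using (sum)
open import Data.List.Relation.Unary.Any using (Any; here; there; any?)
open import Data.List.Membership.Propositional using (_∈_; find; lose)
open import Relation.Nullary using (Dec; yes; no; contradiction)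
open import Relation.Nullary.Decidable using (map′)
open import Relation.Binary.Definitions using (DecidableEquality)
open import Relation.Binary.PropositionalEquality using (_≡_; refl; sym; cong; subst)
open Relation.Binary.PropositionalEquality.≡-Reasoning

private
  variable
    A : Set
    c : Config
    u v w z : Cell
    m n : ℕ

count : (A → Bool) → List A → ℕ
count f xs = sum (map (λ x → toℕ (f x)) xs)

toℕ≤1 : (b : Bool) → toℕ b ≤ 1
toℕ≤1 true  = s≤s z≤n
toℕ≤1 false = z≤n

count≤length : (f : A → Bool) (xs : List A) → count f xs ≤ length xs
count≤length f []       = z≤n
count≤length f (x ∷ xs) = +-mono-≤ (toℕ≤1 (f x)) (count≤length f xs)

count-pos : {f : A → Bool} {x : A} {xs : List A} →
  x ∈ xs → f x ≡ true → 1 ≤ count f xs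
count-pos {f = f} {xs = _ ∷ xs} (here refl) fx rewrite fx = s≤s z≤n
count-pos {f = f} {xs = y ∷ _} (there x∈xs) fx =
  ≤-trans (count-pos x∈xs fx) (m≤n+m _ (toℕ (f y)))

count-pos⁻¹ : (f : A → Bool) (xs : List A) → 1 ≤ count f xs → ∃[ x ] (x ∈ xs × f x ≡ true)
count-pos⁻¹ f (x ∷ xs) pos with f x in fx
... | true  = x , here refl , fx
... | false with count-pos⁻¹ f xs pos
...   | y , y∈xs , fy = y , there y∈xs , fy

count-below : {f : A → Bool} {x : A} {xs : List A} →
  x ∈ xs → f x ≡ false → count f xs < length xs
count-below {f = f} {xs = _ ∷ xs} (here refl) fx rewrite fx = s≤s (count≤length f xs)
count-below {f = f} {xs = y ∷ _} (there x∈xs) fx =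
  +-mono-≤-< (toℕ≤1 (f y)) (count-below x∈xs fx)

inOneTwo-intro : 1 ≤ n → n ≤ 2 → inOneTwo n ≡ true
inOneTwo-intro {1} _ _ = refl
inOneTwo-intro {2} _ _ = refl
inOneTwo-intro {suc (suc (suc _))} _ (s≤s (s≤s ()))

inOneTwo-pos : inOneTwo n ≡ true → 1 ≤ n
inOneTwo-pos {suc _} _ = s≤s z≤n

length-N : (u : Cell) → length (N u) ≡ 3
length-N (_ , _ , up)   = refl
length-N (_ , _ , down) = refl

-- Birth under rule 12: a cell with both an active and an inactive
-- neighbour sees 1 or 2 active neighbours, so it is active after one step.
F-birth : v ∈ N w → c v ≡ true → z ∈ N w → c z ≡ false → F c w ≡ true
F-birth {w = w} {c = c} v∈N cv z∈N cz = begin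
  c w ∨ inOneTwo (count c (N w)) ≡⟨ cong (c w ∨_) (inOneTwo-intro (count-pos v∈N cv) count≤2) ⟩
  c w ∨ true                     ≡⟨ ∨-zeroʳ (c w) ⟩
  true                           ∎
  where
  count≤2 : count c (N w) ≤ 2
  count≤2 = ≤-pred (subst (count c (N w) <_) (length-N w) (count-below z∈N cz))

F-active : (c : Config) (w : Cell) → F c w ≡ true → c w ≡ true ⊎ ∃[ v ] (v ∈ N w × c v ≡ true)
F-active c w Fcw with c w in cw
... | true  = inj₁ refl
... | false = inj₂ (count-pos⁻¹ c (N w) (inOneTwo-pos Fcw))

sub-add : (x a : ℤ) → (x -ℤ a) +ℤ a ≡ x
sub-add x a = begin
  (x +ℤ - a) +ℤ a ≡⟨ ℤₚ.+-assoc x (- a) a ⟩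
  x +ℤ (- a +ℤ a) ≡⟨ cong (x +ℤ_) (ℤₚ.+-inverseˡ a) ⟩
  x +ℤ + 0        ≡⟨ ℤₚ.+-identityʳ x ⟩
  x               ∎

add-sub : (x a : ℤ) → (x +ℤ a) -ℤ a ≡ x
add-sub x a = begin
  (x +ℤ a) +ℤ - a ≡⟨ ℤₚ.+-assoc x a (- a) ⟩
  x +ℤ (a +ℤ - a) ≡⟨ cong (x +ℤ_) (ℤₚ.+-inverseʳ a) ⟩
  x +ℤ + 0        ≡⟨ ℤₚ.+-identityʳ x ⟩
  x               ∎

N-sym : v ∈ N u → u ∈ N v
N-sym {u = x , y , up}   (here refl)                 = here refl
N-sym {u = x , y , up}   (there (here refl))         = there (here (cong (λ a → a , y , up) (sym (sub-add x (+ 1)))))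
N-sym {u = x , y , up}   (there (there (here refl))) = there (there (here (cong (λ b → x , b , up) (sym (sub-add y (+ 1))))))
N-sym {u = x , y , down} (here refl)                 = here refl
N-sym {u = x , y , down} (there (here refl))         = there (here (cong (λ a → a , y , down) (sym (add-sub x (+ 1)))))
N-sym {u = x , y , down} (there (there (here refl))) = there (there (here (cong (λ b → x , b , down) (sym (add-sub y (+ 1))))))

snoc : Walk u w n → v ∈ N w → Walk u v (suc n)
snoc here           v∈N = step v∈N here
snoc (step u∈N walk) v∈N = step u∈N (snoc walk v∈N)

last-step : Walk u v (suc n) → ∃[ w ] (Walk u w n × v ∈ N w)
last-step (step v∈N here)                = _ , here , v∈N
last-step (step w∈N walk@(step _ _)) with last-step walk
... | w , prefix , v∈N = w , step w∈N prefix , v∈N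

_≟-orient_ : DecidableEquality Orient
up   ≟-orient up   = yes refl
up   ≟-orient down = no λ ()
down ≟-orient up   = no λ ()
down ≟-orient down = yes refl

_≟-cell_ : DecidableEquality Cell
_≟-cell_ = ≡-dec ℤ._≟_ (≡-dec ℤ._≟_ _≟-orient_)

walk? : (n : ℕ) (u v : Cell) → Dec (Walk u v n)
walk? zero    u v = map′ (λ { refl → here }) (λ { here → refl }) (u ≟-cell v)
walk? (suc n) u v = map′ fromAny toAny (any? (λ w → walk? n w v) (N u))
  where
  fromAny : Any (λ w → Walk w v n) (N u) → Walk u v (suc n)
  fromAny anyWalk = let (w , w∈N , walk) = find anyWalk in step w∈N walk
  toAny : Walk u v (suc n) → Any (λ w → Walk w v n) (N u)
  toAny (step w∈N walk) = lose w∈N walk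

least : {P : ℕ → Set} → (∀ n → Dec (P n)) → (k : ℕ) → P k →
  ∃[ e ] (P e × e ≤ k × (∀ m → P m → e ≤ m))
least {P} P? = <-rec Least search
  where
  Least : ℕ → Set
  Least k = P k → ∃[ e ] (P e × e ≤ k × (∀ m → P m → e ≤ m))
  search : ∀ k → (∀ {j} → j < k → Least j) → Least k
  search k rec Pk with anyUpTo? P? k
  ... | yes (j , j<k , Pj) = let (e , Pe , e≤j , min) = rec j<k Pj in e , Pe , ≤-trans e≤j (<⇒≤ j<k) , min
  ... | no none = k , Pk , ≤-refl , λ m Pm → ≮⇒≥ λ m<k → none (m , m<k , Pm)

shortest : Walk u v n → ∃[ e ] (Dist u v e × e ≤ n)
shortest {u} {v} {n} walk with least (λ m → walk? m u v) n walk
... | e , geodesic , e≤n , min = e , (geodesic , min) , e≤n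

geodesic-prefix : Dist u v (suc n) → Walk u w n → v ∈ N w → Dist u w n
geodesic-prefix (_ , min) prefix v∈N = prefix , λ m walk → ≤-pred (min (suc m) (snoc walk v∈N))

nearest-walk-bound : {d : ℕ} → NearestActiveDist c u d → c v ≡ true → Walk u v m → d ≤ m
nearest-walk-bound (_ , lower) cv walk with shortest walk
... | e , dist , e≤m = ≤-trans (lower _ e cv dist) e≤m

nearer-inactive : {d : ℕ} → NearestActiveDist c u d → Walk u v m → m < d → c v ≡ false
nearer-inactive {c = c} {v = v} near walk m<d with c v in cv
... | false = refl
... | true  = contradiction (≤-trans m<d (nearest-walk-bound near cv walk)) (<-irrefl refl)

lemma1 : (c : Config) (u : Cell) (d : ℕ) →
    NearestActiveDist c u d → 2 ≤ d →
    NearestActiveDist (F c) u (d ∸ 1)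
lemma1 c u (suc (suc k)) near@((v , cv , geodesic) , _) (s≤s (s≤s z≤n))
  with last-step (proj₁ geodesic)
... | w₁ , toW₁ , v∈N₁ with last-step toW₁
...   | w₂ , toW₂ , w₁∈N₂ = (w₁ , Fw₁ , geodesic-prefix geodesic toW₁ v∈N₁) , lower
  where
  Fw₁ : F c w₁ ≡ true
  Fw₁ = F-birth v∈N₁ cv (N-sym w₁∈N₂) (nearer-inactive near toW₂ (s≤s (m≤n⇒m≤1+n ≤-refl)))
  lower : ∀ v′ e → F c v′ ≡ true → Dist u v′ e → suc k ≤ e
  lower v′ e Fv′ (walk , _) with F-active c v′ Fv′
  ... | inj₁ cv′            = ≤-pred (m≤n⇒m≤1+n (nearest-walk-bound near cv′ walk))
  ... | inj₂ (z , z∈N , cz) = ≤-pred (nearest-walk-bound near cz (snoc walk z∈N))
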